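{- Let $q\ge 4$ be a prime power, fix a primitive element $g_2$ of $\mathbb{F}_q$, and let $t$ be the smallest prime divisor of $(q-1)/2$ if $q$ is odd and the smallest prime divisor of $q-1$ if $q$ is even. Then $$\max_{u}\max_{f_1,f_2\in\mathcal{G}_q,\ f_1\ne f_2} C_{f_1,f_2}(u,0)\le \frac{q-1}{t}-1\quad\text{if } t\notin\{(q-1)/2,\,q-1\},$$ and $$\max_{u}\max_{f_1,f_2\in\mathcal{G}_q,\ f_1\ne f_2} C_{f_1,f_2}(u,0)\le 2\quad\text{otherwise},$$ where $u$ ranges over integers with $1-(q-2)\le u\le (q-2)-1$.
   Context: For a positive integer $n$ and two maps $f_1,f_2:\{1,\ldots,n\}\to\{1,\ldots,n\}$, the cross-correlation $C_{f_1,f_2}(u,v)$ at $(u,v)\in\mathbb{Z}^2$ with $1-n\le u,v\le n-1$ is the number of integers $x\in\{\max\{1,1-u\},\ldots,\min\{n,n-u\}\}$ with $f_1(x)+v=f_2(x+u)$. For a prime power $q$ and primitive elements $g_1,g_2$ of $\mathbb{F}_q$, the Golomb permutation $\pi_{g_1,g_2}$ of $\{1,\ldots,q-2\}$ is defined by $\pi_{g_1,g_2}(i)=h$ if and only if $g_1^i+g_2^h=1$ (with $h\in\{1,\ldots,q-2\}$). With $g_2$ fixed, $\mathcal{G}_q=\{\pi_{g_1,g_2}: g_1 \text{ a primitive element of } \mathbb{F}_q\}$, a family of permutations of $\{1,\ldots,q-2\}$ (so $n=q-2$). -}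

module Defs where

open import Data.Nat as ℕ using (ℕ; zero; suc; _∸_; _≤_; _%_; _/_)
open import Data.Nat.Divisibility using (_∣_)
open import Data.Nat.Primality using (Prime)
open import Data.Integer as ℤ using (ℤ; +_)
open import Data.Fin as Fin using (Fin)
open import Data.List using (List; []; _∷_; map; upTo; filter; length)
open import Data.Bool using (Bool; true; false; if_then_else_)
open import Data.Product using (∃; ∃-syntax; _×_; Σ)
open import Relation.Nullary using (¬_; does)
open import Relation.Nullary.Decidable using (_×-dec_)
open import Relation.Binary.PropositionalEquality using (_≡_; _≢_)
open import Algebra.Structures using (IsCommutativeRing)

-- A finite field with q elements, with carrier Fin q (every finite field of
-- order q is isomorphic to such a structure).
record FiniteField (q : ℕ) : Set where
  infixl 6 _+F_
  infixl 7 _*F_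
  field
    _+F_ _*F_ : Fin q → Fin q → Fin q
    -F_ : Fin q → Fin q
    0F 1F : Fin q
    isCommutativeRing : IsCommutativeRing _≡_ _+F_ _*F_ -F_ 0F 1F
    0≢1 : 0F ≢ 1F
    inverse : ∀ x → x ≢ 0F → ∃[ y ] (x *F y ≡ 1F)

  pow : Fin q → ℕ → Fin q
  pow x zero = 1F
  pow x (suc n) = x *F pow x n

  Primitive : Fin q → Set
  Primitive g = (g ≢ 0F) × (∀ x → x ≢ 0F → ∃[ i ] (pow g i ≡ x))

range1 : ℕ → List ℕ
range1 n = map suc (upTo n)

-- first element of the list satisfying the test (0 if none)
findFirst : (ℕ → Bool) → List ℕ → ℕ
findFirst p [] = 0
findFirst p (x ∷ xs) = if p x then x else findFirst p xs

-- Golomb permutation pi_{g1,g2} of {1,...,q-2}: pi(i) = h iff g1^i + g2^h = 1,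
-- h ∈ {1,...,q-2}  (the unique such h, found by search).
golomb : {q : ℕ} → FiniteField q → Fin q → Fin q → ℕ → ℕ
golomb {q} F g1 g2 i =
  findFirst (λ h → does (pow g1 i +F pow g2 h Fin.≟ 1F)) (range1 (q ∸ 2))
  where open FiniteField F

-- Cross-correlation C_{f1,f2}(u,v) for maps f1 f2 on {1,...,n}: the number of
-- x ∈ {1..n} with 1 ≤ x+u ≤ n (i.e. x ∈ {max(1,1-u),...,min(n,n-u)}) and
-- f1(x) + v = f2(x+u).
crossCorr : (n : ℕ) → (ℕ → ℕ) → (ℕ → ℕ) → ℤ → ℤ → ℕ
crossCorr n f1 f2 u v =
  length (filter (λ x → ((+ 1) ℤ.≤? (+ x ℤ.+ u))
                   ×-dec ((+ x ℤ.+ u) ℤ.≤? (+ n))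
                   ×-dec (((+ f1 x) ℤ.+ v) ℤ.≟ (+ f2 ℤ.∣ + x ℤ.+ u ∣)))
                 (range1 n))

SameMap : ℕ → (ℕ → ℕ) → (ℕ → ℕ) → Set
SameMap n f1 f2 = ∀ x → 1 ≤ x → x ≤ n → f1 x ≡ f2 x

PrimePower : ℕ → Set
PrimePower q = ∃[ p ] ∃[ k ] (Prime p × q ≡ p ℕ.^ suc k)

tBase : ℕ → ℕ
tBase q = if does (q % 2 ℕ.≟ 0) then q ∸ 1 else (q ∸ 1) / 2

SmallestPrimeDivisor : ℕ → ℕ → Set
SmallestPrimeDivisor t m = Prime t × t ∣ m × (∀ p → Prime p → p ∣ m → t ≤ p)

-- Write Q = q - 1 and g₁′ = g₁ᵏ.  As g₁ and g₁′ are both primitive, k is a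
-- unit modulo Q (k·j ≡ 1), and k ≢ 1 because the permutations differ.  By the
-- defining relation gⁱ + g₂^π(i) = 1, the permutations agree at x and x + u
-- iff g₁ˣ = g₁′ˣ⁺ᵘ, i.e. iff x ≡ k(x + u) (mod Q).  Let m be the least
-- positive number with Q ∣ (k - 1)·m and d = Q/m.  Any two solutions differ by
-- a multiple of m, so at most d of them lie in 1, …, Q - 1; moreover d ∣ u,
-- and when m ≤ d the range condition rules out one of the d candidates.
-- Finally m > 1 divides T = tBase q (T = Q, or T = Q/2 where k is odd), so the
-- smallest prime t of T satisfies t ≤ m, hence d ≤ Q/t; and unless t = T,
-- either t < m (so d < Q/t) or t = m with m² ≤ T ≤ Q = d·m, i.e. m ≤ d.
module Submission where

open import Defs
open import Data.Nat using (ℕ; _≤_; _∸_; _/_; NonZero)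
open import Data.Integer using (ℤ; +_; -_)
open import Data.Fin using (Fin)
open import Data.Product using (_×_)
open import Data.Sum using (_⊎_)
open import Relation.Nullary using (¬_)
open import Relation.Binary.PropositionalEquality using (_≡_; _≢_)

open import Level using (0ℓ)
open import Function using (_∘_)
open import Data.Nat as ℕ using (zero; suc; _+_; _*_; _<_; s≤s; z≤n; _%_)
import Data.Nat.Properties as ℕP
open import Data.Nat.DivMod
open import Data.Nat.Divisibility using (_∣_; divides; ∣-refl; ∣-trans; ∣⇒≤; ∣1⇒≡1; ∣m+n∣m⇒∣n; m∣m*n; m%n≡0⇒n∣m; 0∣⇒≡0)
open import Data.Nat.Primality using (Prime; ¬prime[1])
open import Data.Nat.Primality.Factorisation using (factorise)
open import Data.Integer as ℤ using (-[1+_]; +[1+_])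
import Data.Integer.Properties as ℤP
open import Data.Integer.Divisibility.Signed as ℤD using () renaming (_∣_ to _∣ℤ_)
open import Data.Integer.Tactic.RingSolver using (solve-∀)
open import Data.Fin as Fin using (toℕ; fromℕ<; punchIn; punchOut)
import Data.Fin.Properties as FinP
import Data.Product as Product
open import Data.Product using (∃-syntax; _,_; proj₁; proj₂)
open import Data.Sum using (inj₁; inj₂)
open import Data.Empty using (⊥-elim)
open import Relation.Nullary using (contradiction; yes; no; does)
open import Relation.Unary using (Decidable)
open import Relation.Binary.PropositionalEquality using (refl; sym; trans; cong; cong₂; subst; subst₂; module ≡-Reasoning)
open import Relation.Binary.Definitions using (tri<; tri≈; tri>)
open import Data.List using (List; []; _∷_; filter; length; lookup)
open import Data.Nat.ListAction using (product)
open import Data.List.Membership.Propositional using (_∈_)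
open import Data.List.Membership.Propositional.Properties using (∈-map⁺; ∈-map⁻; ∈-upTo⁺; ∈-upTo⁻; ∈-filter⁻; ∈-lookup)
open import Data.List.Relation.Unary.Any using (here; there)
import Data.List.Relation.Unary.All as All
open import Data.List.Relation.Unary.All using (_∷_)
open import Data.List.Relation.Unary.AllPairs using (_∷_)
open import Data.List.Relation.Unary.Unique.Propositional using (Unique)
import Data.List.Relation.Unary.Unique.Propositional.Properties as Unique
open import Algebra.Bundles using (CommutativeRing)
import Algebra.Properties.CommutativeSemiring.Exp as ExpProperties
import Algebra.Properties.Group as GroupProperties

-- `AtMost P B`: at most B numbers satisfy P, witnessed by a code that is
-- injective on P and takes values below B.  All counting goes through this.
record AtMost (P : ℕ → Set) (B : ℕ) : Set where
  field
    code : ℕ → ℕ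
    code-< : ∀ {x} → P x → code x < B
    code-injective : ∀ {x y} → P x → P y → code x ≡ code y → x ≡ y

AtMost-weaken : ∀ {P B B′} → B ≤ B′ → AtMost P B → AtMost P B′
AtMost-weaken B≤B′ c = record
  { code = code ; code-< = λ Px → ℕP.<-≤-trans (code-< Px) B≤B′ ; code-injective = code-injective }
  where open AtMost c

AtMost-restrict : ∀ {P R B} → (∀ {x} → R x → P x) → AtMost P B → AtMost R B
AtMost-restrict R⇒P c = record
  { code = code ; code-< = code-< ∘ R⇒P ; code-injective = λ Rx Ry → code-injective (R⇒P Rx) (R⇒P Ry) }
  where open AtMost c

lookup-distinct : ∀ {xs : List ℕ} → Unique xs → ∀ {i j : Fin (length xs)} →
                  i Fin.< j → lookup xs i ≢ lookup xs j
lookup-distinct (x∉xs ∷ _) {Fin.zero} {Fin.suc j} _ = All.lookup x∉xs (∈-lookup j)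
lookup-distinct (_ ∷ unique) {Fin.suc i} {Fin.suc j} (s≤s i<j) = lookup-distinct unique i<j

filter-length-≤ : ∀ {R : ℕ → Set} (R? : Decidable R) {xs B} → Unique xs →
                  AtMost (λ x → x ∈ xs × R x) B → length (filter R? xs) ≤ B
filter-length-≤ {R} R? {xs} {B} unique c = ℕP.≮⇒≥ too-long
  where
  open AtMost c
  ys : List ℕ
  ys = filter R? xs
  kept : ∀ i → lookup ys i ∈ xs × R (lookup ys i)
  kept i = ∈-filter⁻ R? (∈-lookup i)
  slot : Fin (length ys) → Fin B
  slot i = fromℕ< (code-< (kept i))
  too-long : ¬ B < length ys
  too-long B<len with FinP.pigeonhole B<len slot
  ... | i , j , i<j , same-slot = lookup-distinct (Unique.filter⁺ R? unique) i<j
          (code-injective (kept i) (kept j) (FinP.fromℕ<-injective _ _ _ _ same-slot))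

range1-bounds : ∀ {n x} → x ∈ range1 n → 1 ≤ x × x ≤ n
range1-bounds x∈ with ∈-map⁻ suc x∈
... | i , i∈ , refl = s≤s z≤n , ∈-upTo⁻ i∈

range1-∋ : ∀ {n x} → 1 ≤ x → x ≤ n → x ∈ range1 n
range1-∋ {x = suc x} _ x≤n = ∈-map⁺ suc (∈-upTo⁺ x≤n)

range1-unique : ∀ n → Unique (range1 n)
range1-unique n = Unique.map⁺ ℕP.suc-injective (Unique.upTo⁺ n)

findFirst-sound : ∀ {P : ℕ → Set} (P? : Decidable P) {xs h} → h ∈ xs → P h →
                  P (findFirst (does ∘ P?) xs)
findFirst-sound P? {x ∷ xs} h∈ Ph with P? x
... | yes Px = Px
findFirst-sound P? {x ∷ xs} (here refl) Ph | no ¬Px = ⊥-elim (¬Px Ph)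
findFirst-sound P? {x ∷ xs} (there h∈) Ph | no ¬Px = findFirst-sound P? h∈ Ph

record LeastPositive (P : ℕ → Set) : Set where
  field
    value : ℕ
    positive : 0 < value
    holds : P value
    minimal : ∀ {a} → 0 < a → a < value → ¬ P a

least-positive : ∀ {P : ℕ → Set} → Decidable P → ∀ {n} → 0 < n → P n → LeastPositive P
least-positive {P} P? {n} 0<n Pn =
  search (n ∸ 1) 1 (ℕP.m+[n∸m]≡n 0<n) ℕP.≤-refl (λ 0<a a<1 _ → ℕP.<⇒≱ 0<a (ℕP.≤-pred a<1))
  where
  -- invariant: b + s = n and no positive a < b has P
  search : ∀ s b → b + s ≡ n → 0 < b → (∀ {a} → 0 < a → a < b → ¬ P a) → LeastPositive P
  search s b b+s≡n 0<b below with P? b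
  ... | yes Pb = record { value = b ; positive = 0<b ; holds = Pb ; minimal = below }
  search zero b b+0≡n _ _ | no ¬Pb = ⊥-elim (¬Pb (subst P (trans (sym b+0≡n) (ℕP.+-identityʳ b)) Pn))
  search (suc s) b b+s≡n _ below | no ¬Pb =
    search s (suc b) (trans (sym (ℕP.+-suc b s)) b+s≡n) (s≤s z≤n) below′
    where
    below′ : ∀ {a} → 0 < a → a < suc b → ¬ P a
    below′ 0<a a<1+b with ℕP.m<1+n⇒m<n∨m≡n a<1+b
    ... | inj₁ a<b = below 0<a a<b
    ... | inj₂ refl = ¬Pb

prime-divisor : ∀ {n} → 1 < n → ∃[ p ] (Prime p × p ∣ n)
prime-divisor {n} 1<n with factorise n {{ℕ.>-nonZero (ℕP.<-trans (s≤s z≤n) 1<n)}}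
... | record { factors = [] ; isFactorisation = n≡1 } = contradiction n≡1 (ℕP.>⇒≢ 1<n)
... | record { factors = p ∷ ps ; isFactorisation = n≡p*ps ; factorsPrime = p-prime ∷ _ } =
  p , p-prime , divides (product ps) (trans n≡p*ps (ℕP.*-comm p (product ps)))

smallest-prime-≤ : ∀ {t T m} → SmallestPrimeDivisor t T → 1 < m → m ∣ T → t ≤ m
smallest-prime-≤ (_ , _ , least) 1<m m∣T with prime-divisor 1<m
... | p , p-prime , p∣m = ℕP.≤-trans (least p p-prime (∣-trans p∣m m∣T))
                                      (∣⇒≤ {{ℕ.>-nonZero (ℕP.<-trans (s≤s z≤n) 1<m)}} p∣m)

smallest-prime-square : ∀ {t T} → SmallestPrimeDivisor t T → 0 < T → t ≢ T → t * t ≤ T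
smallest-prime-square (_ , divides zero T≡0 , _) 0<T _ = contradiction T≡0 (ℕP.>⇒≢ 0<T)
smallest-prime-square (_ , divides 1 T≡1*t , _) _ t≢T =
  contradiction (sym (trans T≡1*t (ℕP.*-identityˡ _))) t≢T
smallest-prime-square {t} {T} (_ , divides c@(suc (suc _)) T≡c*t , least) _ _ with prime-divisor {c} (s≤s (s≤s z≤n))
... | p , p-prime , p∣c = subst (t * t ≤_) (sym T≡c*t) (ℕP.*-monoˡ-≤ t t≤c)
  where
  c∣T : c ∣ T
  c∣T = divides t (trans T≡c*t (ℕP.*-comm c t))
  t≤c : t ≤ c
  t≤c = ℕP.≤-trans (least p p-prime (∣-trans p∣c c∣T)) (∣⇒≤ p∣c)

cofactor : ∀ {Q c t} .{{_ : NonZero t}} → Q ≡ c * t → Q / t ≡ c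
cofactor {c = c} {t} Q≡c*t = trans (cong (_/ t) Q≡c*t) (m*n/n≡m c t)

self-cofactor : ∀ {Q t} .{{_ : NonZero t}} → t ≡ Q → Q / t ≡ 1
self-cofactor {t = t} t≡Q = cofactor (trans (sym t≡Q) (sym (ℕP.*-identityˡ t)))

cofactor-< : ∀ {Q d m t} .{{_ : NonZero Q}} .{{_ : NonZero t}} →
             Q ≡ d * m → t ∣ Q → t < m → d < Q / t
cofactor-< {Q} {d} {m} {t} Q≡d*m (divides c Q≡c*t) t<m =
  ℕP.≰⇒> (λ Q/t≤d → ℕP.<⇒≱ t<m (ℕP.*-cancelˡ-≤ c {{c-nonZero}} (begin
    c * m  ≤⟨ ℕP.*-monoˡ-≤ m (subst (_≤ d) (cofactor {c = c} Q≡c*t) Q/t≤d) ⟩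
    d * m  ≡⟨ sym Q≡d*m ⟩
    Q      ≡⟨ Q≡c*t ⟩
    c * t  ∎)))
  where
  open ℕP.≤-Reasoning
  c-nonZero : NonZero c
  c-nonZero = ℕ.>-nonZero (ℕP.n≢0⇒n>0 λ c≡0 → ℕ.≢-nonZero⁻¹ Q (trans Q≡c*t (cong (_* t) c≡0)))

parity : ∀ n → (n % 2 ≡ 0 × suc n % 2 ≡ 1) ⊎ (n % 2 ≡ 1 × suc n % 2 ≡ 0)
parity zero = inj₁ (refl , refl)
parity (suc n) with parity n
... | inj₁ (even , odd) = inj₂ (odd , even)
... | inj₂ (odd , even) = inj₁ (even , odd)

tBase-cases : ∀ Q → (tBase (suc Q) ≡ Q × Q % 2 ≡ 1) ⊎ (tBase (suc Q) ≡ Q / 2 × Q ≡ 2 * (Q / 2))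
tBase-cases Q with parity Q
... | inj₂ (Q-odd , sQ-even) rewrite sQ-even = inj₁ (refl , Q-odd)
... | inj₁ (Q-even , sQ-odd) rewrite sQ-odd = inj₂ (refl , Q≡2*Q/2)
  where
  Q≡2*Q/2 : Q ≡ 2 * (Q / 2)
  Q≡2*Q/2 = trans (m≡m%n+[m/n]*n Q 2) (trans (cong (_+ (Q / 2) * 2) Q-even) (ℕP.*-comm (Q / 2) 2))

odd-half-divisor : ∀ {Q t} → Q % 2 ≡ 1 → t ∣ Q → t ≡ Q / 2 → t ≡ 1
odd-half-divisor {Q} {t} Q-odd t∣Q t≡Q/2 = ∣1⇒≡1 (∣m+n∣m⇒∣n (subst (t ∣_) Q≡t*2+1 t∣Q) (m∣m*n 2))
  where
  Q≡t*2+1 : Q ≡ t * 2 + 1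
  Q≡t*2+1 = trans (m≡m%n+[m/n]*n Q 2)
              (trans (cong₂ (λ r s → r + s * 2) Q-odd (sym t≡Q/2)) (ℕP.+-comm 1 (t * 2)))

pos-∸ : ∀ {a b} → b ≤ a → + (a ∸ b) ≡ + a ℤ.- + b
pos-∸ {a} {b} b≤a = trans (sym (ℤP.⊖-≥ b≤a)) (sym (ℤP.[+m]-[+n]≡m⊖n a b))

pos-divmod : ∀ a n .{{_ : NonZero n}} → + a ≡ + (a % n) ℤ.+ + (a / n) ℤ.* + n
pos-divmod a n = trans (cong +_ (m≡m%n+[m/n]*n a n))
                       (trans (ℤP.pos-+ (a % n) _) (cong (λ z → + (a % n) ℤ.+ z) (ℤP.pos-* (a / n) n)))

%≡⇒∣ : ∀ n .{{_ : NonZero n}} {a b} → a % n ≡ b % n → + n ∣ℤ + a ℤ.- + b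
%≡⇒∣ n {a} {b} a%n≡b%n = ℤD.divides (+ (a / n) ℤ.- + (b / n)) (begin
    + a ℤ.- + b
      ≡⟨ cong₂ ℤ._-_ (pos-divmod a n) (trans (pos-divmod b n) (cong (λ r → + r ℤ.+ + (b / n) ℤ.* + n) (sym a%n≡b%n))) ⟩
    (+ (a % n) ℤ.+ + (a / n) ℤ.* + n) ℤ.- (+ (a % n) ℤ.+ + (b / n) ℤ.* + n)
      ≡⟨ cancel-remainder (+ (a % n)) (+ (a / n)) (+ (b / n)) (+ n) ⟩
    (+ (a / n) ℤ.- + (b / n)) ℤ.* + n ∎)
  where
  open ≡-Reasoning
  cancel-remainder : ∀ r x y n → (r ℤ.+ x ℤ.* n) ℤ.- (r ℤ.+ y ℤ.* n) ≡ (x ℤ.- y) ℤ.* n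
  cancel-remainder = solve-∀

∣∸⇒%≡ : ∀ {n a b} .{{_ : NonZero n}} → b ≤ a → n ∣ a ∸ b → a % n ≡ b % n
∣∸⇒%≡ {n} {a} {b} b≤a (divides c a∸b≡c*n) = begin
  a % n               ≡⟨ cong (_% n) (sym (ℕP.m+[n∸m]≡n b≤a)) ⟩
  (b + (a ∸ b)) % n   ≡⟨ cong (λ x → (b + x) % n) a∸b≡c*n ⟩
  (b + c * n) % n     ≡⟨ [m+kn]%n≡m%n b c n ⟩
  b % n               ∎
  where open ≡-Reasoning

∣⇒%≡ : ∀ {n a b} .{{_ : NonZero n}} → + n ∣ℤ + a ℤ.- + b → a % n ≡ b % n
∣⇒%≡ {n} {a} {b} n∣a-b with ℕP.≤-total b a
... | inj₁ b≤a = ∣∸⇒%≡ b≤a (ℤD.∣⇒∣ᵤ (subst (+ n ∣ℤ_) (sym (pos-∸ b≤a)) n∣a-b))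
... | inj₂ a≤b = sym (∣∸⇒%≡ a≤b (ℤD.∣⇒∣ᵤ (subst (+ n ∣ℤ_) (trans (negate-difference (+ a) (+ b)) (sym (pos-∸ a≤b)))
                                                  (ℤD.∣m⇒∣-m n∣a-b))))
  where
  negate-difference : ∀ x y → ℤ.- (x ℤ.- y) ≡ y ℤ.- x
  negate-difference = solve-∀

module FieldFacts {q : ℕ} (F : FiniteField q) where
  open FiniteField F

  ring : CommutativeRing 0ℓ 0ℓ
  ring = record { isCommutativeRing = isCommutativeRing }

  open CommutativeRing ring using (*-identityˡ; *-identityʳ; *-assoc; *-comm; zeroʳ; -‿inverseʳ; +-identityˡ; +-identityʳ; +-comm; +-assoc)
  open ExpProperties (CommutativeRing.commutativeSemiring ring) using (_^_; ^-homo-*; ^-assocʳ)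
  open GroupProperties (CommutativeRing.+-group ring) using (∙-cancelʳ)

  pow≡^ : ∀ x n → pow x n ≡ x ^ n
  pow≡^ x zero = refl
  pow≡^ x (suc n) = cong (x *F_) (pow≡^ x n)

  pow-+ : ∀ x a b → pow x (a + b) ≡ pow x a *F pow x b
  pow-+ x a b rewrite pow≡^ x (a + b) | pow≡^ x a | pow≡^ x b = ^-homo-* x a b

  pow-* : ∀ x a b → pow x (a * b) ≡ pow (pow x a) b
  pow-* x a b rewrite pow≡^ x (a * b) | pow≡^ (pow x a) b | pow≡^ x a = sym (^-assocʳ x a b)

  pow-1F : ∀ n → pow 1F n ≡ 1F
  pow-1F zero = refl
  pow-1F (suc n) = trans (*-identityˡ _) (pow-1F n)

  +-cancelʳ : ∀ {a b c} → a +F b ≡ c +F b → a ≡ c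
  +-cancelʳ {a} {b} {c} = ∙-cancelʳ b a c

  *-cancelˡ : ∀ {a b c} → a ≢ 0F → a *F b ≡ a *F c → b ≡ c
  *-cancelˡ {a} {b} {c} a≢0 ab≡ac with inverse a a≢0
  ... | a⁻¹ , aa⁻¹≡1 = begin
    b                  ≡⟨ sym (*-identityˡ b) ⟩
    1F *F b            ≡⟨ cong (_*F b) a⁻¹a≡1 ⟨
    (a⁻¹ *F a) *F b    ≡⟨ *-assoc a⁻¹ a b ⟩
    a⁻¹ *F (a *F b)    ≡⟨ cong (a⁻¹ *F_) ab≡ac ⟩
    a⁻¹ *F (a *F c)    ≡⟨ *-assoc a⁻¹ a c ⟨
    (a⁻¹ *F a) *F c    ≡⟨ cong (_*F c) a⁻¹a≡1 ⟩
    1F *F c            ≡⟨ *-identityˡ c ⟩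
    c                  ∎
    where
    open ≡-Reasoning
    a⁻¹a≡1 : a⁻¹ *F a ≡ 1F
    a⁻¹a≡1 = trans (*-comm a⁻¹ a) aa⁻¹≡1

  pow≢0 : ∀ {x} n → x ≢ 0F → pow x n ≢ 0F
  pow≢0 zero _ 1≡0 = 0≢1 (sym 1≡0)
  pow≢0 {x} (suc n) x≢0 x*xⁿ≡0 = pow≢0 n x≢0 (*-cancelˡ x≢0 (trans x*xⁿ≡0 (sym (zeroʳ x))))

  pow-% : ∀ {x} e .{{_ : NonZero e}} → pow x e ≡ 1F → ∀ a → pow x a ≡ pow x (a % e)
  pow-% {x} e xᵉ≡1 a = begin
    pow x a                                ≡⟨ cong (pow x) (m≡m%n+[m/n]*n a e) ⟩
    pow x (a % e + (a / e) * e)            ≡⟨ pow-+ x (a % e) _ ⟩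
    pow x (a % e) *F pow x ((a / e) * e)   ≡⟨ cong (λ z → pow x (a % e) *F pow x z) (ℕP.*-comm (a / e) e) ⟩
    pow x (a % e) *F pow x (e * (a / e))   ≡⟨ cong (pow x (a % e) *F_) (pow-* x e (a / e)) ⟩
    pow x (a % e) *F pow (pow x e) (a / e) ≡⟨ cong (λ y → pow x (a % e) *F pow y (a / e)) xᵉ≡1 ⟩
    pow x (a % e) *F pow 1F (a / e)        ≡⟨ cong (pow x (a % e) *F_) (pow-1F (a / e)) ⟩
    pow x (a % e) *F 1F                    ≡⟨ *-identityʳ _ ⟩
    pow x (a % e)                          ∎
    where open ≡-Reasoning

  pow-∸ : ∀ {x a b} → x ≢ 0F → a ≤ b → pow x a ≡ pow x b → pow x (b ∸ a) ≡ 1F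
  pow-∸ {x} {a} {b} x≢0 a≤b xᵃ≡xᵇ = sym (*-cancelˡ (pow≢0 a x≢0) (begin
    pow x a *F 1F            ≡⟨ *-identityʳ _ ⟩
    pow x a                  ≡⟨ xᵃ≡xᵇ ⟩
    pow x b                  ≡⟨ cong (pow x) (ℕP.m+[n∸m]≡n a≤b) ⟨
    pow x (a + (b ∸ a))      ≡⟨ pow-+ x a (b ∸ a) ⟩
    pow x a *F pow x (b ∸ a) ∎))
    where open ≡-Reasoning

  complement : ∀ a → a +F (1F +F -F a) ≡ 1F
  complement a = begin
    a +F (1F +F -F a)   ≡⟨ cong (a +F_) (+-comm 1F (-F a)) ⟩
    a +F (-F a +F 1F)   ≡⟨ +-assoc a (-F a) 1F ⟨
    (a +F -F a) +F 1F   ≡⟨ cong (_+F 1F) (-‿inverseʳ a) ⟩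
    0F +F 1F            ≡⟨ +-identityˡ 1F ⟩
    1F                  ∎
    where open ≡-Reasoning

module PrimitiveElement {Q′ : ℕ} (F : FiniteField (suc (suc Q′))) (g : Fin (suc (suc Q′)))
                        (g-primitive : FiniteField.Primitive F g) where
  open FiniteField F
  open FieldFacts F

  Q : ℕ
  Q = suc Q′

  g≢0 : g ≢ 0F
  g≢0 = proj₁ g-primitive

  nonzero : Fin Q → Fin (suc Q)
  nonzero = punchIn 0F

  log : Fin Q → ℕ
  log j = proj₁ (proj₂ g-primitive (nonzero j) (FinP.punchInᵢ≢i 0F j))

  pow-log : ∀ j → pow g (log j) ≡ nonzero j
  pow-log j = proj₂ (proj₂ g-primitive (nonzero j) (FinP.punchInᵢ≢i 0F j))

  -- If gᵉ = 1 with e > 0, all Q nonzero elements are among g⁰, …, gᵉ⁻¹, so Q ≤ e.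
  order-≥ : ∀ {e} → 0 < e → pow g e ≡ 1F → Q ≤ e
  order-≥ {e@(suc _)} _ gᵉ≡1 = ℕP.≮⇒≥ too-small
    where
    too-small : ¬ e < Q
    too-small e<Q with FinP.pigeonhole e<Q (λ j → fromℕ< (m%n<n (log j) e))
    ... | i , j , i<j , same-residue = FinP.<⇒≢ i<j (FinP.punchIn-injective 0F i j (begin
      nonzero i          ≡⟨ pow-log i ⟨
      pow g (log i)      ≡⟨ pow-% e gᵉ≡1 (log i) ⟩
      pow g (log i % e)  ≡⟨ cong (pow g) (FinP.fromℕ<-injective _ _ _ _ same-residue) ⟩
      pow g (log j % e)  ≡⟨ pow-% e gᵉ≡1 (log j) ⟨
      pow g (log j)      ≡⟨ pow-log j ⟩
      nonzero j          ∎))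
      where open ≡-Reasoning

  0≢pow : ∀ (i : Fin (suc Q)) → 0F ≢ pow g (toℕ i)
  0≢pow i = pow≢0 (toℕ i) g≢0 ∘ sym

  -- Two of the Q + 1 nonzero values g⁰, …, g^Q coincide, so gᵉ = 1 for some 0 < e ≤ Q.
  order-≤ : ∃[ e ] (0 < e × e ≤ Q × pow g e ≡ 1F)
  order-≤ with FinP.pigeonhole (ℕP.n<1+n Q) (λ i → punchOut (0≢pow i))
  ... | i , j , i<j , same =
    toℕ j ∸ toℕ i , ℕP.m<n⇒0<n∸m i<j , ℕP.≤-trans (ℕP.m∸n≤m (toℕ j) (toℕ i)) (ℕP.≤-pred (FinP.toℕ<n j)) ,
    pow-∸ {a = toℕ i} {b = toℕ j} g≢0 (ℕP.<⇒≤ i<j) (FinP.punchOut-injective (0≢pow i) (0≢pow j) same)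

  pow-Q : pow g Q ≡ 1F
  pow-Q = order-is-Q order-≤
    where
    order-is-Q : ∃[ e ] (0 < e × e ≤ Q × pow g e ≡ 1F) → pow g Q ≡ 1F
    order-is-Q (e , 0<e , e≤Q , gᵉ≡1) = subst (λ n → pow g n ≡ 1F) (ℕP.≤-antisym e≤Q (order-≥ 0<e gᵉ≡1)) gᵉ≡1

  pow-mod : ∀ a → pow g a ≡ pow g (a % Q)
  pow-mod = pow-% Q pow-Q

  pow-cong : ∀ {a b} → a % Q ≡ b % Q → pow g a ≡ pow g b
  pow-cong {a} {b} a≡b = trans (pow-mod a) (trans (cong (pow g) a≡b) (sym (pow-mod b)))

  pow-distinct : ∀ {a b} → a < b → b < Q → pow g a ≢ pow g b
  pow-distinct {a} {b} a<b b<Q gᵃ≡gᵇ = ℕP.<⇒≱ (ℕP.≤-<-trans (ℕP.m∸n≤m b a) b<Q)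
    (order-≥ (ℕP.m<n⇒0<n∸m a<b) (pow-∸ {a = a} {b = b} g≢0 (ℕP.<⇒≤ a<b) gᵃ≡gᵇ))

  pow-injective : ∀ {a b} → pow g a ≡ pow g b → a % Q ≡ b % Q
  pow-injective {a} {b} gᵃ≡gᵇ with ℕP.<-cmp (a % Q) (b % Q)
  ... | tri≈ _ a≡b _ = a≡b
  ... | tri< a<b _ _ = ⊥-elim (pow-distinct a<b (m%n<n b Q) (trans (sym (pow-mod a)) (trans gᵃ≡gᵇ (pow-mod b))))
  ... | tri> _ _ b<a = ⊥-elim (pow-distinct b<a (m%n<n a Q) (trans (sym (pow-mod b)) (trans (sym gᵃ≡gᵇ) (pow-mod a))))

-- The Golomb permutation is well defined: for 0 < i < Q the search finds h
-- with g₁ⁱ + g₂ʰ = 1 (h = log (1 - g₁ⁱ), which lies in 1, …, Q - 1).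
module GolombProperty {Q′ : ℕ} (F : FiniteField (suc (suc Q′))) (g₁ g₂ : Fin (suc (suc Q′)))
                      (g₁-primitive : FiniteField.Primitive F g₁) (g₂-primitive : FiniteField.Primitive F g₂) where
  open FiniteField F
  open FieldFacts F
  open CommutativeRing ring using (+-identityˡ; +-identityʳ)
  module G₁ = PrimitiveElement F g₁ g₁-primitive
  module G₂ = PrimitiveElement F g₂ g₂-primitive
  open G₁ using (Q)

  golomb-spec : ∀ {i} → 0 < i → i < Q → pow g₁ i +F pow g₂ (golomb F g₁ g₂ i) ≡ 1F
  golomb-spec {i} 0<i i<Q =
    findFirst-sound (λ h → pow g₁ i +F pow g₂ h Fin.≟ 1F) (range1-∋ 0<h (ℕP.≤-pred h<Q)) gⁱ+gʰ≡1
    where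
    c : Fin (suc Q)
    c = 1F +F -F pow g₁ i
    -- c = 0 would mean g₁ⁱ = 1 = g₁⁰, impossible for 0 < i < Q
    c≢0 : c ≢ 0F
    c≢0 c≡0 = ℕP.>⇒≢ 0<i (trans (sym (m<n⇒m%n≡m i<Q)) (G₁.pow-injective {i} {0} gⁱ≡1))
      where
      gⁱ≡1 : pow g₁ i ≡ 1F
      gⁱ≡1 = trans (sym (+-identityʳ _)) (trans (cong (pow g₁ i +F_) (sym c≡0)) (complement _))
    logc : ℕ
    logc = proj₁ (proj₂ g₂-primitive c c≢0)
    h : ℕ
    h = logc % Q
    h<Q : h < Q
    h<Q = m%n<n logc Q
    gʰ≡c : pow g₂ h ≡ c
    gʰ≡c = trans (sym (G₂.pow-mod logc)) (proj₂ (proj₂ g₂-primitive c c≢0))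
    gⁱ+gʰ≡1 : pow g₁ i +F pow g₂ h ≡ 1F
    gⁱ+gʰ≡1 = trans (cong (pow g₁ i +F_) gʰ≡c) (complement _)
    -- h = 0 would mean c = 1, i.e. g₁ⁱ = 0
    0<h : 0 < h
    0<h = ℕP.n≢0⇒n>0 λ h≡0 → pow≢0 i G₁.g≢0 (+-cancelʳ (begin
      pow g₁ i +F 1F        ≡⟨ cong (λ e → pow g₁ i +F pow g₂ e) h≡0 ⟨
      pow g₁ i +F pow g₂ h  ≡⟨ gⁱ+gʰ≡1 ⟩
      1F                    ≡⟨ +-identityˡ 1F ⟨
      0F +F 1F              ∎))
      where open ≡-Reasoning

-- A solution is an x with
-- x ≡ k·(x + u) (mod Q); solutions differ by multiples of the additive order
-- m of k - 1 modulo Q, which leaves room for at most d = Q/m of them.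
module Solutions (Q′ k j : ℕ) (u : ℤ)
                 (k-unit : + suc Q′ ∣ℤ + k ℤ.* + j ℤ.- + 1)
                 (k≢1 : ¬ (+ suc Q′ ∣ℤ + k ℤ.- + 1)) where

  Q : ℕ
  Q = suc Q′

  Annihilated : ℕ → Set
  Annihilated a = + Q ∣ℤ (+ k ℤ.- + 1) ℤ.* + a

  Q-annihilated : Annihilated Q
  Q-annihilated = ℤD.divides (+ k ℤ.- + 1) refl

  least-annihilated : LeastPositive Annihilated
  least-annihilated = least-positive (λ a → + Q ℤD.∣? (+ k ℤ.- + 1) ℤ.* + a) (s≤s z≤n) Q-annihilated

  open LeastPositive least-annihilated
    renaming (value to m; positive to 0<m; holds to m-annihilated; minimal to m-minimal)

  instance
    m-nonZero : NonZero m
    m-nonZero = ℕ.>-nonZero 0<m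

  -- The annihilated numbers are the multiples of m: the remainder a % m is
  -- again annihilated, and smaller than m.
  annihilated⇒m∣ : ∀ {a} → Annihilated a → m ∣ a
  annihilated⇒m∣ {a} a-annihilated = m%n≡0⇒n∣m a m (ℕP.n≤0⇒n≡0 (ℕP.≮⇒≥ λ 0<r →
      m-minimal 0<r (m%n<n a m) remainder-annihilated))
    where
    remove-multiple : ∀ K R D M → K ℤ.* R ≡ K ℤ.* (R ℤ.+ D ℤ.* M) ℤ.- D ℤ.* (K ℤ.* M)
    remove-multiple = solve-∀
    remainder-annihilated : Annihilated (a % m)
    remainder-annihilated = subst (+ Q ∣ℤ_)
      (sym (trans (remove-multiple (+ k ℤ.- + 1) (+ (a % m)) (+ (a / m)) (+ m))
                  (cong (λ z → (+ k ℤ.- + 1) ℤ.* z ℤ.- + (a / m) ℤ.* ((+ k ℤ.- + 1) ℤ.* + m)) (sym (pos-divmod a m)))))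
      (ℤD.∣m∣n⇒∣m-n a-annihilated (ℤD.∣n⇒∣m*n (+ (a / m)) m-annihilated))

  1<m : 1 < m
  1<m = ℕP.≤∧≢⇒< 0<m λ 1≡m → k≢1 (subst (+ Q ∣ℤ_) (ℤP.*-identityʳ _) (subst Annihilated (sym 1≡m) m-annihilated))

  m∣Q : m ∣ Q
  m∣Q = annihilated⇒m∣ Q-annihilated

  d : ℕ
  d = _∣_.quotient m∣Q

  Q≡d*m : Q ≡ d * m
  Q≡d*m = _∣_.equality m∣Q

  Solution : ℕ → Set
  Solution x = + Q ∣ℤ + x ℤ.- + k ℤ.* (+ x ℤ.+ u)

  solution-difference : ∀ {x y} → Solution x → Solution y → y ≤ x → Annihilated (x ∸ y)
  solution-difference {x} {y} x-sol y-sol y≤x =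
    subst (+ Q ∣ℤ_) (sym (trans (cong ((+ k ℤ.- + 1) ℤ.*_) (pos-∸ y≤x)) (difference (+ k) (+ x) (+ y) u)))
          (ℤD.∣m⇒∣-m (ℤD.∣m∣n⇒∣m-n x-sol y-sol))
    where
    difference : ∀ k x y u → (k ℤ.- + 1) ℤ.* (x ℤ.- y) ≡ ℤ.- ((x ℤ.- k ℤ.* (x ℤ.+ u)) ℤ.- (y ℤ.- k ℤ.* (y ℤ.+ u)))
    difference = solve-∀

  solutions-congruent : ∀ {x y} → Solution x → Solution y → x % m ≡ y % m
  solutions-congruent {x} {y} x-sol y-sol with ℕP.≤-total y x
  ... | inj₁ y≤x = ∣∸⇒%≡ y≤x (annihilated⇒m∣ (solution-difference x-sol y-sol y≤x))
  ... | inj₂ x≤y = sym (∣∸⇒%≡ x≤y (annihilated⇒m∣ (solution-difference y-sol x-sol x≤y)))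

  solution-by-quotient : ∀ {x y} → Solution x → Solution y → x / m ≡ y / m → x ≡ y
  solution-by-quotient {x} {y} x-sol y-sol x/m≡y/m = begin
    x                   ≡⟨ m≡m%n+[m/n]*n x m ⟩
    x % m + (x / m) * m ≡⟨ cong₂ (λ r s → r + s * m) (solutions-congruent x-sol y-sol) x/m≡y/m ⟩
    y % m + (y / m) * m ≡⟨ m≡m%n+[m/n]*n y m ⟨
    y                   ∎
    where open ≡-Reasoning

  -- If a solution exists then d ∣ u: from Q ∣ (k-1)·m and kj ≡ 1 one gets
  -- Q ∣ m·u, i.e. d·m ∣ u·m.
  d∣u : ∀ {x} → Solution x → d ∣ ℤ.∣ u ∣
  d∣u {x} x-sol = ℤD.∣⇒∣ᵤ (ℤD.*-cancelʳ-∣ (+ m) {+ d} {u} dm∣um)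
    where
    eliminate-k : ∀ m u j x k → m ℤ.* u ≡
      j ℤ.* (ℤ.- (m ℤ.* (x ℤ.- k ℤ.* (x ℤ.+ u))) ℤ.- x ℤ.* ((k ℤ.- + 1) ℤ.* m)) ℤ.- (k ℤ.* j ℤ.- + 1) ℤ.* (m ℤ.* u)
    eliminate-k = solve-∀
    Q∣mu : + Q ∣ℤ + m ℤ.* u
    Q∣mu = subst (+ Q ∣ℤ_) (sym (eliminate-k (+ m) u (+ j) (+ x) (+ k)))
      (ℤD.∣m∣n⇒∣m-n (ℤD.∣n⇒∣m*n (+ j) (ℤD.∣m∣n⇒∣m-n (ℤD.∣m⇒∣-m (ℤD.∣n⇒∣m*n (+ m) x-sol))
                                                    (ℤD.∣n⇒∣m*n (+ x) m-annihilated)))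
                    (ℤD.∣m⇒∣m*n (+ m ℤ.* u) k-unit))
    dm∣um : + d ℤ.* + m ∣ℤ u ℤ.* + m
    dm∣um = subst₂ _∣ℤ_ (trans (cong +_ Q≡d*m) (ℤP.pos-* d m)) (ℤP.*-comm (+ m) u) Q∣mu

  -- If Q = 2h, then k is odd (2 ∤ k since k is a unit), so (k-1)·h = ((k-1)/2)·Q.
  k-odd : ∀ {h} → Q ≡ 2 * h → k % 2 ≡ 1
  k-odd {h} Q≡2h with parity k
  ... | inj₂ (k%2≡1 , _) = k%2≡1
  ... | inj₁ (k%2≡0 , _) = contradiction (∣1⇒≡1 (ℤD.∣⇒∣ᵤ 2∣1)) λ ()
    where
    2∣kj : + 2 ∣ℤ + k ℤ.* + j
    2∣kj = ℤD.∣m⇒∣m*n (+ j) (ℤD.∣ᵤ⇒∣ {+ 2} {+ k} (m%n≡0⇒n∣m k 2 k%2≡0))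
    2∣Q : + 2 ∣ℤ + Q
    2∣Q = ℤD.∣ᵤ⇒∣ (divides h (trans Q≡2h (ℕP.*-comm 2 h)))
    difference-is-one : ∀ a → a ℤ.- (a ℤ.- + 1) ≡ + 1
    difference-is-one = solve-∀
    2∣1 : + 2 ∣ℤ + 1
    2∣1 = subst (+ 2 ∣ℤ_) (difference-is-one (+ k ℤ.* + j)) (ℤD.∣m∣n⇒∣m-n 2∣kj (ℤD.∣-trans 2∣Q k-unit))

  half-annihilated : ∀ {h} → Q ≡ 2 * h → Annihilated h
  half-annihilated {h} Q≡2h = ℤD.divides (+ (k / 2)) (begin
    (+ k ℤ.- + 1) ℤ.* + h                       ≡⟨ cong (λ z → (z ℤ.- + 1) ℤ.* + h) k≡1+2c ⟩
    (+ 1 ℤ.+ + (k / 2) ℤ.* + 2 ℤ.- + 1) ℤ.* + h ≡⟨ halve (+ (k / 2)) (+ h) ⟩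
    + (k / 2) ℤ.* (+ 2 ℤ.* + h)                 ≡⟨ cong (λ z → + (k / 2) ℤ.* z) 2h≡Q ⟩
    + (k / 2) ℤ.* + Q                           ∎)
    where
    open ≡-Reasoning
    halve : ∀ c h → (+ 1 ℤ.+ c ℤ.* + 2 ℤ.- + 1) ℤ.* h ≡ c ℤ.* (+ 2 ℤ.* h)
    halve = solve-∀
    k≡1+2c : + k ≡ + 1 ℤ.+ + (k / 2) ℤ.* + 2
    k≡1+2c = trans (pos-divmod k 2) (cong (λ r → + r ℤ.+ + (k / 2) ℤ.* + 2) (k-odd {h} Q≡2h))
    2h≡Q : + 2 ℤ.* + h ≡ + Q
    2h≡Q = trans (sym (ℤP.pos-* 2 h)) (cong +_ (sym Q≡2h))

  record Admissible (x : ℕ) : Set where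
    field
      lower : 1 ≤ x
      upper : x ≤ Q′
      shifted-lower : + 1 ℤ.≤ + x ℤ.+ u
      shifted-upper : + x ℤ.+ u ℤ.≤ + Q′
      solution : Solution x
  open Admissible

  at-most-d : AtMost Admissible d
  at-most-d = record
    { code = _/ m
    ; code-< = λ {x} x-adm → m<n*o⇒m/o<n (subst (x <_) Q≡d*m (s≤s (upper x-adm)))
    ; code-injective = λ x-adm y-adm → solution-by-quotient (solution x-adm) (solution y-adm)
    }

  -- If every admissible x is at least m, the quotient 0 is never used.
  at-most-d∸1-from-below : (∀ {x} → Admissible x → m ≤ x) → AtMost Admissible (d ∸ 1)
  at-most-d∸1-from-below m≤ = record
    { code = λ x → x / m ∸ 1
    ; code-< = λ x-adm → ℕP.∸-monoˡ-< (AtMost.code-< at-most-d x-adm) (1≤x/m x-adm)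
    ; code-injective = λ x-adm y-adm eq →
        solution-by-quotient (solution x-adm) (solution y-adm) (ℕP.∸-cancelʳ-≡ (1≤x/m x-adm) (1≤x/m y-adm) eq)
    }
    where
    1≤x/m : ∀ {x} → Admissible x → 1 ≤ x / m
    1≤x/m x-adm = m≥n⇒m/n>0 (m≤ x-adm)

  -- If every admissible x satisfies x + m < Q, the quotient d - 1 is never used.
  at-most-d∸1-from-above : (∀ {x} → Admissible x → x + m < Q) → AtMost Admissible (d ∸ 1)
  at-most-d∸1-from-above <Q = record
    { code = _/ m
    ; code-< = λ {x} x-adm → m<n*o⇒m/o<n (subst (x <_) Q∸m≡[d∸1]*m (x<Q∸m (<Q x-adm)))
    ; code-injective = λ x-adm y-adm → solution-by-quotient (solution x-adm) (solution y-adm)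
    }
    where
    x<Q∸m : ∀ {x} → x + m < Q → x < Q ∸ m
    x<Q∸m {x} x+m<Q = subst (_< Q ∸ m) (ℕP.m+n∸n≡m x m) (ℕP.∸-monoˡ-< x+m<Q (ℕP.m≤n+m m x))
    Q∸m≡[d∸1]*m : Q ∸ m ≡ (d ∸ 1) * m
    Q∸m≡[d∸1]*m = trans (cong₂ _∸_ Q≡d*m (sym (ℕP.*-identityˡ m))) (sym (ℕP.*-distribʳ-∸ m d 1))

  -- When m ≤ d one of the d quotients is excluded by the range condition:
  -- for u = 0 solutions are multiples of m; for u ≠ 0, d ∣ u forces |u| ≥ d ≥ m,
  -- which pushes x above m (u < 0) or x + m below Q (u > 0).
  at-most-d∸1 : m ≤ d → AtMost Admissible (d ∸ 1)
  at-most-d∸1 m≤d = by-shift u refl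
    where
    by-shift : ∀ w → u ≡ w → AtMost Admissible (d ∸ 1)
    by-shift (+ 0) u≡0 = at-most-d∸1-from-below λ x-adm →
      ∣⇒≤ {{ℕ.>-nonZero (lower x-adm)}} (annihilated⇒m∣ (annihilated (solution x-adm)))
      where
      annihilate : ∀ k x → (k ℤ.- + 1) ℤ.* x ≡ ℤ.- (x ℤ.- k ℤ.* (x ℤ.+ + 0))
      annihilate = solve-∀
      annihilated : ∀ {x} → Solution x → Annihilated x
      annihilated {x} x-sol = subst (+ Q ∣ℤ_) (sym (annihilate (+ k) (+ x)))
        (ℤD.∣m⇒∣-m (subst (λ w → + Q ∣ℤ + x ℤ.- + k ℤ.* (+ x ℤ.+ w)) u≡0 x-sol))
    by-shift -[1+ v ] u≡-1-v = at-most-d∸1-from-below λ {x} x-adm →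
      ℕP.≤-trans m≤d (ℕP.≤-trans (d≤1+v x-adm)
        (ℕP.<⇒≤ (above-shift (subst (λ w → + 1 ℤ.≤ + x ℤ.+ w) u≡-1-v (shifted-lower x-adm)))))
      where
      d≤1+v : ∀ {x} → Admissible x → d ≤ suc v
      d≤1+v x-adm = ∣⇒≤ (subst (λ w → d ∣ ℤ.∣ w ∣) u≡-1-v (d∣u (solution x-adm)))
      cancel-shift : ∀ x w → (x ℤ.- w) ℤ.+ w ≡ x
      cancel-shift = solve-∀
      above-shift : ∀ {x} → + 1 ℤ.≤ + x ℤ.+ -[1+ v ] → suc v < x
      above-shift {x} 1≤x-1-v = ℤP.drop‿+≤+ (subst (+ (suc (suc v)) ℤ.≤_) (cancel-shift (+ x) +[1+ v ])
                                                  (ℤP.+-monoˡ-≤ +[1+ v ] 1≤x-1-v))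
    by-shift +[1+ v ] u≡1+v = at-most-d∸1-from-above λ {x} x-adm →
      s≤s (ℕP.≤-trans (ℕP.+-monoʳ-≤ x (ℕP.≤-trans m≤d (d≤1+v x-adm)))
                      (ℤP.drop‿+≤+ (subst (λ w → + x ℤ.+ w ℤ.≤ + Q′) u≡1+v (shifted-upper x-adm))))
      where
      d≤1+v : ∀ {x} → Admissible x → d ≤ suc v
      d≤1+v x-adm = ∣⇒≤ (subst (λ w → d ∣ ℤ.∣ w ∣) u≡1+v (d∣u (solution x-adm)))

  -- With t the smallest prime divisor of an annihilated divisor T of Q:
  -- m ∣ T gives t ≤ m, hence d ≤ Q/t; and unless t = T, either t < m (so
  -- d < Q/t) or t = m, in which case m² = t² ≤ T ≤ Q = d·m gives m ≤ d.
  smallest-prime-bounds : ∀ {T t} .{{_ : NonZero t}} → Annihilated T → T ∣ Q → SmallestPrimeDivisor t T →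
                          AtMost Admissible (Q / t) × (t ≢ T → AtMost Admissible (Q / t ∸ 1))
  smallest-prime-bounds {T} {t} T-annihilated T∣Q t-smallest@(_ , t∣T , _) =
    AtMost-weaken d≤Q/t at-most-d , unless-prime
    where
    t≤m : t ≤ m
    t≤m = smallest-prime-≤ t-smallest 1<m (annihilated⇒m∣ T-annihilated)
    d≤Q/t : d ≤ Q / t
    d≤Q/t = subst (_≤ Q / t) (cofactor Q≡d*m) (/-monoʳ-≤ Q t≤m)
    0<T : 0 < T
    0<T = ℕP.n≢0⇒n>0 λ T≡0 → ℕP.1+n≢0 (0∣⇒≡0 (subst (_∣ Q) T≡0 T∣Q))
    unless-prime : t ≢ T → AtMost Admissible (Q / t ∸ 1)
    unless-prime t≢T = by-comparison (ℕP.m≤n⇒m<n∨m≡n t≤m)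
      where
      by-comparison : t < m ⊎ t ≡ m → AtMost Admissible (Q / t ∸ 1)
      by-comparison (inj₁ t<m) = AtMost-weaken (ℕP.<⇒≤pred (cofactor-< Q≡d*m (∣-trans t∣T T∣Q) t<m)) at-most-d
      by-comparison (inj₂ t≡m) = AtMost-weaken (ℕP.∸-monoˡ-≤ 1 d≤Q/t) (at-most-d∸1 m≤d)
        where
        m≤d : m ≤ d
        m≤d = ℕP.*-cancelʳ-≤ m d m (begin
          m * m  ≡⟨ cong₂ _*_ t≡m t≡m ⟨
          t * t  ≤⟨ smallest-prime-square t-smallest 0<T t≢T ⟩
          T      ≤⟨ ∣⇒≤ T∣Q ⟩
          Q      ≡⟨ Q≡d*m ⟩
          d * m  ∎)
          where open ℕP.≤-Reasoning

  correlation-bounds : ∀ t .{{_ : NonZero t}} → SmallestPrimeDivisor t (tBase (suc Q)) →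
                       (t ≢ Q / 2 × t ≢ Q → AtMost Admissible (Q / t ∸ 1)) ×
                       (t ≡ Q / 2 ⊎ t ≡ Q → AtMost Admissible 2)
  correlation-bounds t t-smallest with tBase-cases Q
  ... | inj₁ (T≡Q , Q-odd) = (λ (_ , t≢Q) → proj₂ bounds t≢Q) , small
    where
    t-smallest′ : SmallestPrimeDivisor t Q
    t-smallest′ = subst (SmallestPrimeDivisor t) T≡Q t-smallest
    bounds : AtMost Admissible (Q / t) × (t ≢ Q → AtMost Admissible (Q / t ∸ 1))
    bounds = smallest-prime-bounds Q-annihilated ∣-refl t-smallest′
    small : t ≡ Q / 2 ⊎ t ≡ Q → AtMost Admissible 2
    small (inj₁ t≡Q/2) = ⊥-elim (¬prime[1] (subst Prime (odd-half-divisor Q-odd (proj₁ (proj₂ t-smallest′)) t≡Q/2)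
                                                         (proj₁ t-smallest′)))
    small (inj₂ t≡Q) = AtMost-weaken (ℕP.≤-trans (ℕP.≤-reflexive (self-cofactor t≡Q)) (s≤s z≤n)) (proj₁ bounds)
  ... | inj₂ (T≡Q/2 , Q≡2*Q/2) = (λ (t≢Q/2 , _) → proj₂ bounds t≢Q/2) , small
    where
    bounds : AtMost Admissible (Q / t) × (t ≢ Q / 2 → AtMost Admissible (Q / t ∸ 1))
    bounds = smallest-prime-bounds (half-annihilated Q≡2*Q/2) (divides 2 Q≡2*Q/2)
                                   (subst (SmallestPrimeDivisor t) T≡Q/2 t-smallest)
    small : t ≡ Q / 2 ⊎ t ≡ Q → AtMost Admissible 2
    small (inj₁ t≡Q/2) = AtMost-weaken (ℕP.≤-reflexive (cofactor {c = 2} (trans Q≡2*Q/2 (cong (2 *_) (sym t≡Q/2)))))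
                                       (proj₁ bounds)
    small (inj₂ t≡Q) = AtMost-weaken (ℕP.≤-trans (ℕP.≤-reflexive (self-cofactor t≡Q)) (s≤s z≤n)) (proj₁ bounds)

-- Two Golomb permutations for the same g₂ and primitive g₁, g₁′ = g₁ᵏ:
-- their values agree at x and y only if x ≡ k·y (mod Q), so their correlation
-- at shift u is bounded by the number of admissible solutions of the congruence.
module GolombPair {Q′ : ℕ} (F : FiniteField (suc (suc Q′))) (g₁ g₁′ g₂ : Fin (suc (suc Q′)))
                  (g₁-primitive : FiniteField.Primitive F g₁) (g₁′-primitive : FiniteField.Primitive F g₁′)
                  (g₂-primitive : FiniteField.Primitive F g₂) (u : ℤ)
                  (differ : ¬ SameMap Q′ (golomb F g₁ g₂) (golomb F g₁′ g₂)) where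
  open FiniteField F
  open FieldFacts F
  open CommutativeRing ring using (*-identityʳ)
  module G₁ = PrimitiveElement F g₁ g₁-primitive
  module π₁ = GolombProperty F g₁ g₂ g₁-primitive g₂-primitive
  module π₁′ = GolombProperty F g₁′ g₂ g₁′-primitive g₂-primitive
  open G₁ using (Q)

  k j : ℕ
  k = proj₁ (proj₂ g₁-primitive g₁′ (proj₁ g₁′-primitive))
  j = proj₁ (proj₂ g₁′-primitive g₁ (proj₁ g₁-primitive))

  g₁ᵏ≡g₁′ : pow g₁ k ≡ g₁′
  g₁ᵏ≡g₁′ = proj₂ (proj₂ g₁-primitive g₁′ (proj₁ g₁′-primitive))

  g₁′ʲ≡g₁ : pow g₁′ j ≡ g₁
  g₁′ʲ≡g₁ = proj₂ (proj₂ g₁′-primitive g₁ (proj₁ g₁-primitive))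

  -- g₁ᵏʲ = g₁, so k·j ≡ 1 (mod Q).
  k-unit : + Q ∣ℤ + k ℤ.* + j ℤ.- + 1
  k-unit = subst (λ z → + Q ∣ℤ z ℤ.- + 1) (ℤP.pos-* k j) (%≡⇒∣ Q {k * j} {1} (G₁.pow-injective {k * j} {1} g₁ᵏʲ≡g₁¹))
    where
    g₁ᵏʲ≡g₁¹ : pow g₁ (k * j) ≡ pow g₁ 1
    g₁ᵏʲ≡g₁¹ = trans (pow-* g₁ k j) (trans (cong (λ y → pow y j) g₁ᵏ≡g₁′) (trans g₁′ʲ≡g₁ (sym (*-identityʳ g₁))))

  -- k ≡ 1 (mod Q) would give g₁′ = g₁ and equal permutations.
  k≢1 : ¬ (+ Q ∣ℤ + k ℤ.- + 1)
  k≢1 Q∣k-1 = differ (λ x _ _ → cong (λ g → golomb F g g₂ x) g₁≡g₁′)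
    where
    g₁≡g₁′ : g₁ ≡ g₁′
    g₁≡g₁′ = trans (sym (*-identityʳ g₁)) (trans (G₁.pow-cong {1} {k} (sym (∣⇒%≡ {Q} {k} {1} Q∣k-1))) g₁ᵏ≡g₁′)

  open Solutions Q′ k j u k-unit k≢1 public hiding (Q)

  -- Equal Golomb values at x and y force g₁ˣ = g₁′ʸ = g₁ᵏʸ, i.e. x ≡ k·y (mod Q).
  match⇒congruent : ∀ {x y} → 0 < x → x < Q → 0 < y → y < Q →
                    golomb F g₁ g₂ x ≡ golomb F g₁′ g₂ y → + Q ∣ℤ + x ℤ.- + k ℤ.* + y
  match⇒congruent {x} {y} 0<x x<Q 0<y y<Q same =
    subst (λ z → + Q ∣ℤ + x ℤ.- z) (ℤP.pos-* k y) (%≡⇒∣ Q {x} {k * y} (G₁.pow-injective {x} {k * y} g₁ˣ≡g₁ᵏʸ))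
    where
    g₁ˣ≡g₁′ʸ : pow g₁ x ≡ pow g₁′ y
    g₁ˣ≡g₁′ʸ = +-cancelʳ (trans (π₁.golomb-spec 0<x x<Q)
      (sym (subst (λ h → pow g₁′ y +F pow g₂ h ≡ 1F) (sym same) (π₁′.golomb-spec 0<y y<Q))))
    g₁ˣ≡g₁ᵏʸ : pow g₁ x ≡ pow g₁ (k * y)
    g₁ˣ≡g₁ᵏʸ = trans g₁ˣ≡g₁′ʸ (trans (cong (λ z → pow z y) (sym g₁ᵏ≡g₁′)) (sym (pow-* g₁ k y)))

  counted⇒admissible : ∀ {x} → x ∈ range1 Q′ →
    (+ 1 ℤ.≤ + x ℤ.+ u) × (+ x ℤ.+ u ℤ.≤ + Q′) × (+ golomb F g₁ g₂ x ℤ.+ + 0 ≡ + golomb F g₁′ g₂ ℤ.∣ + x ℤ.+ u ∣) →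
    Admissible x
  counted⇒admissible {x} x∈ (1≤x+u , x+u≤Q′ , same) = record
    { lower = 1≤x ; upper = x≤Q′ ; shifted-lower = 1≤x+u ; shifted-upper = x+u≤Q′
    ; solution = subst (λ z → + Q ∣ℤ + x ℤ.- + k ℤ.* z) y≡x+u
        (match⇒congruent 1≤x (s≤s x≤Q′) 1≤y (s≤s y≤Q′) (cong ℤ.∣_∣ (trans (sym (ℤP.+-identityʳ (+ golomb F g₁ g₂ x))) same)))
    }
    where
    1≤x : 1 ≤ x
    1≤x = proj₁ (range1-bounds x∈)
    x≤Q′ : x ≤ Q′
    x≤Q′ = proj₂ (range1-bounds x∈)
    y : ℕ
    y = ℤ.∣ + x ℤ.+ u ∣
    y≡x+u : + y ≡ + x ℤ.+ u
    y≡x+u = ℤP.0≤i⇒+∣i∣≡i (ℤP.≤-trans (ℤ.+≤+ z≤n) 1≤x+u)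
    1≤y : 1 ≤ y
    1≤y = ℤP.drop‿+≤+ (subst (+ 1 ℤ.≤_) (sym y≡x+u) 1≤x+u)
    y≤Q′ : y ≤ Q′
    y≤Q′ = ℤP.drop‿+≤+ (subst (ℤ._≤ + Q′) (sym y≡x+u) x+u≤Q′)

  correlation-≤ : ∀ {B} → AtMost Admissible B → crossCorr Q′ (golomb F g₁ g₂) (golomb F g₁′ g₂) u (+ 0) ≤ B
  correlation-≤ = filter-length-≤ _ (range1-unique Q′) ∘ AtMost-restrict (λ (x∈ , counted) → counted⇒admissible x∈ counted)

lemma2 : (q : ℕ) → 4 ≤ q → PrimePower q → (F : FiniteField q) →
         (g₂ : Fin q) → FiniteField.Primitive F g₂ →
         (t : ℕ) → SmallestPrimeDivisor t (tBase q) → .{{_ : NonZero t}} →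
         (u : ℤ) → (+ 1) Data.Integer.- (+ (q ∸ 2)) Data.Integer.≤ u → u Data.Integer.≤ (+ (q ∸ 2)) Data.Integer.- (+ 1) →
         (g₁ g₁′ : Fin q) → FiniteField.Primitive F g₁ → FiniteField.Primitive F g₁′ →
         ¬ SameMap (q ∸ 2) (golomb F g₁ g₂) (golomb F g₁′ g₂) →
         ((t ≢ (q ∸ 1) / 2 × t ≢ q ∸ 1) →
            crossCorr (q ∸ 2) (golomb F g₁ g₂) (golomb F g₁′ g₂) u (+ 0) ≤ ((q ∸ 1) / t) ∸ 1)
         × ((t ≡ (q ∸ 1) / 2 ⊎ t ≡ q ∸ 1) →
            crossCorr (q ∸ 2) (golomb F g₁ g₂) (golomb F g₁′ g₂) u (+ 0) ≤ 2)
lemma2 (suc (suc (suc (suc _)))) (s≤s (s≤s (s≤s (s≤s _)))) _ F g₂ g₂-primitive t t-smallest u _ _ g₁ g₁′ g₁-primitive g₁′-primitive differ =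
  Product.map (correlation-≤ ∘_) (correlation-≤ ∘_) (correlation-bounds t t-smallest)
  where open GolombPair F g₁ g₁′ g₂ g₁-primitive g₁′-primitive g₂-primitive u differ
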